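{- Let $C$ be a conjunctive type expression with $pos(C)\neq\emptyset$. Then $[\![C]\!]=\emptyset$ if and only if for every $f\in\bigcap_{\alpha\in pos(C)}\mathcal F(\alpha)$, $$\Big(\bigcap_{\omega\in pos(C)}[\![\textstyle\bigsqcup\mathcal A^f_\omega]\!]\Big)\cap\Big(\bigcap_{\tau\in neg(C)}\big(T(\Sigma)^{arity(f)}\setminus[\![\textstyle\bigsqcup\mathcal A^f_\tau]\!]\big)\Big)=\emptyset.$$
   Context: Let $\Sigma$ be a finite ranked alphabet of function symbols containing at least one constant, and $T(\Sigma)$ the set of ground terms over $\Sigma$. Let $\Pi$ be a finite ranked alphabet of type constructors, disjoint from $\Sigma$ and from $\{\sqcap,\sqcup,\neg,\top,\bot\}$. A type expression is a ground term over $\Pi\cup\{\sqcap,\sqcup,\neg,\top,\bot\}$ ($\sqcap,\sqcup$ binary, $\neg$ unary, $\top,\bot$ constants). A type rule has the form $c(\zeta_1,\dots,\zeta_m)\to\tau$ with $c\in\Pi$ of arity $m$, $\zeta_i$ distinct type parameters. $\Delta$ is a fixed finite set of type rules which is simplified: every right-hand side is $f(\tau_1,\dots,\tau_n)$ with $f\in\Sigma$ of arity $n$ and each $\tau_j$ either some $\zeta_i$ or $d(\zeta'_1,\dots,\zeta'_k)$ with $d\in\Pi$, $\zeta'_l\in\{\zeta_1,\dots,\zeta_m\}$. $ground(\Delta)$ is the set of all rules obtained from rules of $\Delta$ by replacing the parameters by type expressions, together with $\top\to f(\top,\dots,\top)$ for all $f\in\Sigma$. Semantics: $[\![\top]\!]=T(\Sigma)$,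 $[\![\bot]\!]=\emptyset$, $[\![E_1\sqcap E_2]\!]=[\![E_1]\!]\cap[\![E_2]\!]$, $[\![E_1\sqcup E_2]\!]=[\![E_1]\!]\cup[\![E_2]\!]$, $[\![\neg E]\!]=T(\Sigma)\setminus[\![E]\!]$, and for $\omega$ with principal symbol in $\Pi$, $[\![\omega]\!]=\bigcup_{(\omega\to f(E_1,\dots,E_n))\in ground(\Delta)}\{f(t_1,\dots,t_n): t_i\in[\![E_i]\!]\}$. For a sequence $\langle E_1,\dots,E_k\rangle$, $[\![\langle E_1,\dots,E_k\rangle]\!]=[\![E_1]\!]\times\dots\times[\![E_k]\!]$ (and $\{\epsilon\}$ if $k=0$). A type atom is a type expression whose principal symbol is in $\Pi\cup\{\top,\bot\}$; a type literal is a type atom or $\neg$ of a type atom; a conjunctive type expression $C$ is a $\sqcap$-conjunction of type literals, $pos(C)$ the set of atoms occurring positively in it, $neg(C)$ the set of atoms $\tau$ with $\neg\tau$ in it. For a type atom $\alpha$ and $f\in\Sigma$ of arity $k$: $\mathcal F(\alpha)=\{f\in\Sigma: \exists E_1,\dots,E_k,\ (\alpha\to f(E_1,\dots,E_k))\in ground(\Delta)\}$, $\mathcal A^f_\alpha=\{\langle \alpha_1,\dots,\alpha_k\rangle : (\alpha\to f(\alpha_1,\dots,\alpha_k))\in ground(\Delta)\}$, and $[\![\bigsqcup\mathcal A^f_\alpha]\!]=\bigcup_{\gamma\in\mathcal A^f_\alpha}[\![\gamma]\!]$. -}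

module Defs where

open import Data.Nat using (ℕ)
open import Data.Fin using (Fin)
open import Data.List using (List)
open import Data.List.Membership.Propositional using (_∈_)
open import Data.Product using (Σ; _×_; ∃)
open import Data.Sum using (_⊎_)
open import Data.Unit using () renaming (⊤ to Unit)
open import Data.Empty using () renaming (⊥ to Empty)
open import Relation.Binary.PropositionalEquality using (_≡_)

-- Finite ranked alphabets: Σ (function symbols) and Π (type constructors),
-- each given as Fin n with an arity map.  Π is disjoint from Σ and from the
-- type connectives by construction (separate datatypes).
record Sig : Set where
  field
    nΣ  : ℕ
    arΣ : Fin nΣ → ℕ
    nΠ  : ℕ
    arΠ : Fin nΠ → ℕ
open Sig public

HasConstant : Sig → Set
HasConstant S = ∃ λ (f : Fin (nΣ S)) → arΣ S f ≡ 0

module _ (S : Sig) where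

  data Term : Set where
    node : (f : Fin (nΣ S)) → (Fin (arΣ S f) → Term) → Term

  data TExp : Set where
    tc  : (c : Fin (nΠ S)) → (Fin (arΠ S c) → TExp) → TExp
    _⊓_ : TExp → TExp → TExp
    _⊔_ : TExp → TExp → TExp
    ¬ₜ  : TExp → TExp
    ⊤ₜ  : TExp
    ⊥ₜ  : TExp

  -- Argument of a simplified right-hand side, for a rule whose left-hand
  -- side has m parameters ζ_0 … ζ_{m-1}: either a parameter ζ_i, or
  -- d(ζ'_1,…,ζ'_k) with d ∈ Π and each ζ'_l a parameter.
  data RArg (m : ℕ) : Set where
    param : Fin m → RArg m
    con   : (d : Fin (nΠ S)) → (Fin (arΠ S d) → Fin m) → RArg m

  -- A simplified type rule c(ζ_1,…,ζ_m) → f(τ_1,…,τ_n).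
  record Rule : Set where
    field
      lhs  : Fin (nΠ S)
      head : Fin (nΣ S)
      rhs  : Fin (arΣ S head) → RArg (arΠ S lhs)
  open Rule public

  instArg : ∀ {m} → (Fin m → TExp) → RArg m → TExp
  instArg σ (param i) = σ i
  instArg σ (con d ι) = tc d (λ l → σ (ι l))

  data Atom : TExp → Set where
    atom-tc : ∀ c σ → Atom (tc c σ)
    atom-⊤  : Atom ⊤ₜ
    atom-⊥  : Atom ⊥ₜ

  data Literal : TExp → Set where
    lit-pos : ∀ {α} → Atom α → Literal α
    lit-neg : ∀ {α} → Atom α → Literal (¬ₜ α)

  data Conj : TExp → Set where
    conj-lit : ∀ {L} → Literal L → Conj L
    conj-⊓   : ∀ {C₁ C₂} → Conj C₁ → Conj C₂ → Conj (C₁ ⊓ C₂)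

  data InPos (α : TExp) : TExp → Set where
    here  : Atom α → InPos α α
    left  : ∀ {C₁ C₂} → InPos α C₁ → InPos α (C₁ ⊓ C₂)
    right : ∀ {C₁ C₂} → InPos α C₂ → InPos α (C₁ ⊓ C₂)

  data InNeg (τ : TExp) : TExp → Set where
    here  : Atom τ → InNeg τ (¬ₜ τ)
    left  : ∀ {C₁ C₂} → InNeg τ C₁ → InNeg τ (C₁ ⊓ C₂)
    right : ∀ {C₁ C₂} → InNeg τ C₂ → InNeg τ (C₁ ⊓ C₂)

  module Sem (Δ : List Rule) where

    -- GRule ω f Es  :⇔  (ω → f(Es)) ∈ ground(Δ)
    data GRule : TExp → (f : Fin (nΣ S)) → (Fin (arΣ S f) → TExp) → Set where
      top  : ∀ f → GRule ⊤ₜ f (λ _ → ⊤ₜ)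
      inst : (r : Rule) → r ∈ Δ → (σ : Fin (arΠ S (lhs r)) → TExp) →
             GRule (tc (lhs r) σ) (head r) (λ j → instArg σ (rhs r j))

    ⟦_⟧∋_ : TExp → Term → Set
    ⟦ tc c σ ⟧∋ node f ts =
      Σ (Fin (arΣ S f) → TExp) λ Es → GRule (tc c σ) f Es × (∀ i → ⟦ Es i ⟧∋ ts i)
    ⟦ E₁ ⊓ E₂ ⟧∋ t = ⟦ E₁ ⟧∋ t × ⟦ E₂ ⟧∋ t
    ⟦ E₁ ⊔ E₂ ⟧∋ t = ⟦ E₁ ⟧∋ t ⊎ ⟦ E₂ ⟧∋ t
    ⟦ ¬ₜ E ⟧∋ t = ⟦ E ⟧∋ t → Empty
    ⟦ ⊤ₜ ⟧∋ t = Unit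
    ⟦ ⊥ₜ ⟧∋ t = Empty

    _∈𝓕_ : Fin (nΣ S) → TExp → Set
    f ∈𝓕 α = Σ (Fin (arΣ S f) → TExp) λ Es → GRule α f Es

    -- ts ∈ [[ ⊔ 𝓐^f_α ]]
    InA : (f : Fin (nΣ S)) → TExp → (Fin (arΣ S f) → Term) → Set
    InA f α ts = Σ (Fin (arΣ S f) → TExp) λ Es → GRule α f Es × (∀ i → ⟦ Es i ⟧∋ ts i)

{-# OPTIONS --safe #-}

-- Every term is some node f ts, and for an atom α we have node f ts ∈ ⟦α⟧ iff
-- ts ∈ ⟦⊔ 𝓐^f_α⟧: for a constructor atom this is the definition, ⊤ contributes
-- the rule ⊤ → f(⊤,…,⊤), and ⊥ has no rules.  A conjunctive C denotes the
-- intersection of its literals, so node f ts ∈ ⟦C⟧ iff ts lies in the set of the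
-- right-hand side; the restriction to f ∈ ⋂ 𝓕(α) is harmless because
-- ts ∈ ⟦⊔ 𝓐^f_α⟧ already forces f ∈ 𝓕(α).
module Submission where

open import Defs
open import Data.Fin using (Fin)
open import Data.List using (List)
open import Data.Product using (_×_; ∃; _,_; proj₁; map₂)
open import Data.Unit using (tt)
open import Relation.Nullary using (¬_)
open import Function.Bundles using (_⇔_; mk⇔; Equivalence)
open import Function.Construct.Composition using (_⇔-∘_)

open Equivalence using (to; from)

module _ {S : Sig} where

  InPos⇒Atom : ∀ {α C} → InPos S α C → Atom S α
  InPos⇒Atom (here a)  = a
  InPos⇒Atom (left p)  = InPos⇒Atom p
  InPos⇒Atom (right p) = InPos⇒Atom p

  InNeg⇒Atom : ∀ {τ C} → InNeg S τ C → Atom S τ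
  InNeg⇒Atom (here a)  = a
  InNeg⇒Atom (left p)  = InNeg⇒Atom p
  InNeg⇒Atom (right p) = InNeg⇒Atom p

module _ {S : Sig} {Δ : List (Rule S)} where
  open Sem S Δ

  InA⇒∈𝓕 : ∀ {f α ts} → InA f α ts → f ∈𝓕 α
  InA⇒∈𝓕 = map₂ proj₁

  ⟦atom⟧⇔InA : ∀ {α f ts} → Atom S α → ⟦ α ⟧∋ node f ts ⇔ InA f α ts
  ⟦atom⟧⇔InA (atom-tc c σ)    = mk⇔ (λ x → x) (λ x → x)
  ⟦atom⟧⇔InA {f = f} atom-⊤ = mk⇔ (λ _ → (λ _ → ⊤ₜ) , top f , λ _ → tt) (λ _ → tt)
  ⟦atom⟧⇔InA atom-⊥           = mk⇔ (λ ()) (λ { (_ , () , _) })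

  SatisfiesLiterals : TExp S → Term S → Set
  SatisfiesLiterals C t =
    (∀ α → InPos S α C → ⟦ α ⟧∋ t) × (∀ τ → InNeg S τ C → ¬ ⟦ τ ⟧∋ t)

  ArgumentsSatisfyLiterals : TExp S → (f : Fin (nΣ S)) → (Fin (arΣ S f) → Term S) → Set
  ArgumentsSatisfyLiterals C f ts =
    (∀ ω → InPos S ω C → InA f ω ts) × (∀ τ → InNeg S τ C → ¬ InA f τ ts)

  ⟦⟧⇒⟦pos⟧ : ∀ {α C t} → InPos S α C → ⟦ C ⟧∋ t → ⟦ α ⟧∋ t
  ⟦⟧⇒⟦pos⟧ (here _)  m       = m
  ⟦⟧⇒⟦pos⟧ (left p)  (m , _) = ⟦⟧⇒⟦pos⟧ p m
  ⟦⟧⇒⟦pos⟧ (right p) (_ , m) = ⟦⟧⇒⟦pos⟧ p m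

  ⟦⟧⇒¬⟦neg⟧ : ∀ {τ C t} → InNeg S τ C → ⟦ C ⟧∋ t → ¬ ⟦ τ ⟧∋ t
  ⟦⟧⇒¬⟦neg⟧ (here _)  m       = m
  ⟦⟧⇒¬⟦neg⟧ (left p)  (m , _) = ⟦⟧⇒¬⟦neg⟧ p m
  ⟦⟧⇒¬⟦neg⟧ (right p) (_ , m) = ⟦⟧⇒¬⟦neg⟧ p m

  SatisfiesLiterals⇒⟦conj⟧ : ∀ {C t} → Conj S C → SatisfiesLiterals C t → ⟦ C ⟧∋ t
  SatisfiesLiterals⇒⟦conj⟧ (conj-lit (lit-pos a)) (P , _) = P _ (here a)
  SatisfiesLiterals⇒⟦conj⟧ (conj-lit (lit-neg a)) (_ , N) = N _ (here a)
  SatisfiesLiterals⇒⟦conj⟧ (conj-⊓ c₁ c₂) (P , N) =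
    SatisfiesLiterals⇒⟦conj⟧ c₁ ((λ α p → P α (left p)) , (λ τ p → N τ (left p))) ,
    SatisfiesLiterals⇒⟦conj⟧ c₂ ((λ α p → P α (right p)) , (λ τ p → N τ (right p)))

  ⟦conj⟧⇔SatisfiesLiterals : ∀ {C t} → Conj S C → ⟦ C ⟧∋ t ⇔ SatisfiesLiterals C t
  ⟦conj⟧⇔SatisfiesLiterals c =
    mk⇔ (λ m → (λ α p → ⟦⟧⇒⟦pos⟧ p m) , (λ τ p → ⟦⟧⇒¬⟦neg⟧ p m))
        (SatisfiesLiterals⇒⟦conj⟧ c)

  SatisfiesLiterals⇔ArgumentsSatisfyLiterals :
    ∀ {C f ts} → SatisfiesLiterals C (node f ts) ⇔ ArgumentsSatisfyLiterals C f ts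
  SatisfiesLiterals⇔ArgumentsSatisfyLiterals = mk⇔
    (λ (P , N) → (λ ω p → to (⟦atom⟧⇔InA (InPos⇒Atom p)) (P ω p)) ,
                 (λ τ p a → N τ p (from (⟦atom⟧⇔InA (InNeg⇒Atom p)) a)))
    (λ (P , N) → (λ ω p → from (⟦atom⟧⇔InA (InPos⇒Atom p)) (P ω p)) ,
                 (λ τ p m → N τ p (to (⟦atom⟧⇔InA (InNeg⇒Atom p)) m)))

  ⟦conj⟧⇔ArgumentsSatisfyLiterals :
    ∀ {C f ts} → Conj S C → ⟦ C ⟧∋ node f ts ⇔ ArgumentsSatisfyLiterals C f ts
  ⟦conj⟧⇔ArgumentsSatisfyLiterals c =
    SatisfiesLiterals⇔ArgumentsSatisfyLiterals ⇔-∘ ⟦conj⟧⇔SatisfiesLiterals c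

lemma3 : (S : Sig) → (Δ : List (Rule S)) → HasConstant S →
         (C : TExp S) → Conj S C → ∃ (λ α → InPos S α C) →
         ((t : Term S) → ¬ (Sem.⟦_⟧∋_ S Δ C t))
         ⇔
         ((f : Fin (nΣ S)) → (∀ α → InPos S α C → Sem._∈𝓕_ S Δ f α) →
          (ts : Fin (arΣ S f) → Term S) →
          ¬ ((∀ ω → InPos S ω C → Sem.InA S Δ f ω ts) ×
             (∀ τ → InNeg S τ C → ¬ Sem.InA S Δ f τ ts)))
lemma3 S Δ _ C c _ = mk⇔
  (λ empty f _ ts args → empty (node f ts) (from (⟦conj⟧⇔ArgumentsSatisfyLiterals c) args))
  (λ { noArgs (node f ts) m →
         let args = to (⟦conj⟧⇔ArgumentsSatisfyLiterals c) m
         in noArgs f (λ α p → InA⇒∈𝓕 (proj₁ args α p)) ts args })
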